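{- Let $G$ be a graph, $C$ a longest cycle in $G$ with a fixed orientation, and $P$ a longest path in $G\setminus V(C)$ with endpoints $x,y$ (possibly $x=y$) and length $\overline{p}\ge 0$. Suppose $N_C(x)=N_C(y)$ and $|N_C(x)|\ge 2$. Let $\xi_1,\dots,\xi_s$ be the elements of $N_C(x)\cup N_C(y)$ in consecutive order along the orientation of $C$, let $I_i$ be the segment of $C$ from $\xi_i$ to $\xi_{i+1}$ in the chosen direction ($i=1,\dots,s$, $\xi_{s+1}=\xi_1$), and let $|I_i|$ denote its length (number of edges). Let $f,g\in\{1,\dots,s\}$. (a1) If $L\in\Upsilon(I_f,I_g)$, then $|I_f|+|I_g|\ge 2\overline{p}+2|L|+4$. (a2) If every path in $\Upsilon(I_f,I_g)$ is a single edge and $|\Upsilon(I_f,I_g)|=\varepsilon$ for some $\varepsilon\in\{1,2,3\}$, then $|I_f|+|I_g|\ge 2\overline{p}+\varepsilon+5$. (a3) If every path in $\Upsilon(I_f,I_g)$ is a single edge and $\Upsilon(I_f,I_g)$ contains two independent edges (edges with no common vertex), then $|I_f|+|I_g|\ge 2\overline{p}+8$.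
   Context: Graphs are finite, simple, undirected; lengths of paths and cycles are numbers of edges. $N_C(v)=N(v)\cap V(C)$. The segments $I_1,\dots,I_s$ are called elementary segments; $I_i^\ast$ denotes the set of internal vertices of $I_i$ (the vertices strictly between $\xi_i$ and $\xi_{i+1}$ along $I_i$). For two distinct elementary segments $I_a,I_b$, an intermediate path between $I_a$ and $I_b$ is a path $L$ with endpoints $z\in I_a^\ast$ and $w\in I_b^\ast$ such that $V(L)\cap V(C\cup P)=\{z,w\}$. $\Upsilon(I_f,I_g)$ denotes the set of all intermediate paths between $I_f$ and $I_g$ (empty if $f=g$). -}

module Defs where

open import Data.Nat using (ℕ; _+_; _∸_; _≤_; _<_; _≤?_)
open import Data.Fin using (Fin; toℕ)
open import Data.List using (List; []; _∷_; _∷ʳ_; length)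
open import Data.List.Relation.Unary.All using (All)
open import Data.List.Relation.Unary.Linked using (Linked)
open import Data.List.Relation.Unary.Unique.Propositional using (Unique)
open import Data.List.Membership.Propositional using (_∈_; _∉_)
open import Data.Product using (Σ; _×_; _,_; ∃)
open import Data.Sum using (_⊎_)
open import Relation.Nullary using (¬_; yes; no)
open import Relation.Binary.PropositionalEquality using (_≡_; _≢_)
open import Function.Definitions using (Injective)

record Graph : Set₁ where
  field
    n      : ℕ
    Adj    : Fin n → Fin n → Set
    sym    : ∀ {u v} → Adj u v → Adj v u
    irrefl : ∀ {v} → ¬ Adj v v

  Vertex : Set
  Vertex = Fin n

fdist : ∀ {k} → Fin k → Fin k → ℕ
fdist {k} a b with toℕ a ≤? toℕ b
... | yes _ = toℕ b ∸ toℕ a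
... | no  _ = k + toℕ b ∸ toℕ a

module _ (G : Graph) where
  open Graph G

  IsPath : List Vertex → Set
  IsPath xs = (xs ≢ []) × Unique xs × Linked Adj xs

  plen : List Vertex → ℕ
  plen xs = length xs ∸ 1

  -- A cycle of length k, listed along a fixed orientation: c i is followed by
  -- c j whenever fdist i j ≡ 1 (i.e. j = i+1 mod k).
  IsCycle : ∀ {k} → (Fin k → Vertex) → Set
  IsCycle {k} c = (3 ≤ k) × Injective _≡_ _≡_ c
                × (∀ i j → fdist i j ≡ 1 → Adj (c i) (c j))

  IsLongestCycle : ∀ {k} → (Fin k → Vertex) → Set
  IsLongestCycle {k} c =
    IsCycle c × (∀ k′ (c′ : Fin k′ → Vertex) → IsCycle c′ → k′ ≤ k)

  AvoidsCycle : ∀ {k} → (Fin k → Vertex) → List Vertex → Set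
  AvoidsCycle c Q = ∀ j → c j ∉ Q

  IsLongestPathOff : ∀ {k} → (Fin k → Vertex) → List Vertex → Set
  IsLongestPathOff c P = IsPath P × AvoidsCycle c P
    × (∀ Q → IsPath Q → AvoidsCycle c Q → plen Q ≤ plen P)

  -- |N_C(x)| ≥ 2 (c is injective, so distinct positions give distinct vertices)
  AtLeastTwoCNbrs : ∀ {k} → (Fin k → Vertex) → Vertex → Set
  AtLeastTwoCNbrs c x = Σ _ λ j → Σ _ λ j′ → (j ≢ j′) × Adj x (c j) × Adj x (c j′)

module Setting (G : Graph) {k : ℕ} (c : Fin k → Graph.Vertex G)
               (x y : Graph.Vertex G) (P : List (Graph.Vertex G)) where
  open Graph G

  Xi : Fin k → Set
  Xi j = Adj x (c j) ⊎ Adj y (c j)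

  Between : Fin k → Fin k → Fin k → Set
  Between a b j = (0 < fdist a j) × (fdist a j < fdist a b)

  -- An elementary segment I_i, given by the positions (a , b) of ξ_i and ξ_{i+1}:
  -- consecutive elements of N_C(x) ∪ N_C(y) along the orientation.
  IsSeg : Fin k × Fin k → Set
  IsSeg (a , b) = (a ≢ b) × Xi a × Xi b × (∀ j → Between a b j → ¬ Xi j)

  segLen : Fin k × Fin k → ℕ
  segLen (a , b) = fdist a b

  Interior : Fin k × Fin k → Fin k → Set
  Interior (a , b) j = Between a b j

  -- A candidate intermediate path: z = c j, w = c j′, inner vertices ms;
  -- its vertex list is z , ms , w.
  Triple : Set
  Triple = Fin k × Fin k × List Vertex

  pathOf : Triple → List Vertex
  pathOf (j , j′ , ms) = c j ∷ (ms ∷ʳ c j′)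

  Llen : Triple → ℕ
  Llen (_ , _ , ms) = length ms + 1

  -- t ∈ Υ(S , T)   (empty when S = T)
  InΥ : Fin k × Fin k → Fin k × Fin k → Triple → Set
  InΥ S T (j , j′ , ms) =
    (S ≢ T) × Interior S j × Interior T j′ × IsPath G (pathOf (j , j′ , ms))
    × All (λ v → (∀ i → v ≢ c i) × v ∉ P) ms

  HasCard : (Triple → Set) → ℕ → Set
  HasCard Q m = ∃ λ (ts : List Triple) →
    (length ts ≡ m) × Unique ts × All Q ts × (∀ t → Q t → t ∈ ts)

  Independent : Triple → Triple → Set
  Independent (j₁ , j₁′ , _) (j₂ , j₂′ , _) =
    (c j₁ ≢ c j₂) × (c j₁ ≢ c j₂′) × (c j₁′ ≢ c j₂) × (c j₁′ ≢ c j₂′)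

module Submission where

-- Each bound compares the length of a cycle with |C|.  As N_C(x) = N_C(y), the path P from x to y
-- closes into a cycle through any two ends of the segments I_f = ξ_f ⋯ ξ_{f+1} and I_g = ξ_g ⋯ ξ_{g+1}.
-- Let L run from z ∈ I_f to w ∈ I_g, at distances Z from ξ_f and W from ξ_g.  The cycles
--   P, ξ_g back along C to z, L, w forward along C to ξ_f        and
--   P, ξ_{g+1} forward along C to z, L, w back along C to ξ_{f+1}
-- give p + |L| + 2 ≤ Z + W and p + |L| + 2 + Z + W ≤ |I_f| + |I_g|, whose sum is (a1).  For single
-- edges the same pair of cycles shows that two edges whose weights Z + W differ by at least d force
-- 2p + 6 + d ≤ |I_f| + |I_g|.  Distinct edges with a common end have distinct weights and three distinct
-- weights spread by at least 2, which gives (a2).  Independent edges either have weights two apart or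
-- cross (Z₁ < Z₂ and W₂ < W₁); two crossing edges lie on the cycle
--   P, ξ_{f+1} forward along C to w₂, z₂ back along C to z₁, w₁ forward along C to ξ_f
-- and on its mirror image, and adding both bounds gives (a3).

open import Defs
open import Data.Nat using (ℕ; zero; suc; _+_; _*_; _∸_; _≤_; _<_; _≤?_; z≤n; s≤s; NonZero)
open import Data.Nat.Base using (>-nonZero)
open import Data.Nat.Properties
open import Data.Nat.DivMod using (_%_; _/_; m≡m%n+[m/n]*n; %-distribˡ-+; m%n%n≡m%n; [m+n]%n≡m%n; m<n⇒m%n≡m; m%n<n)
open import Data.Nat.Tactic.RingSolver using (solve-∀)
open import Data.Fin using (Fin; toℕ; zero; suc; fromℕ<)
open import Data.Fin.Properties using (toℕ<n; toℕ-injective; toℕ-fromℕ<) renaming (_≟_ to _≟ᶠ_)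
open import Data.List using (List; []; _∷_; [_]; length; lookup; head; last; _++_; map; _∷ʳ_)
open import Data.List.Properties using (length-++; length-map; head-map; last-map; ++-conicalˡ)
open import Data.List.Relation.Unary.All using (All; []; _∷_)
import Data.List.Relation.Unary.All as All
open import Data.List.Relation.Unary.Any using (here; there)
open import Data.List.Relation.Unary.AllPairs using ([]; _∷_)
open import Data.List.Relation.Unary.Linked using (Linked; []; [-]; _∷_)
import Data.List.Relation.Unary.Linked as Linked
import Data.List.Relation.Unary.Linked.Properties as Linked
open import Data.List.Relation.Unary.Unique.Propositional using (Unique)
import Data.List.Relation.Unary.Unique.Propositional.Properties as Unique
open import Data.List.Membership.Propositional using (_∈_; _∉_)
open import Data.List.Membership.Propositional.Properties using (∈-lookup; ∈-++⁻; ∈-map⁻)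
open import Data.Maybe using (just)
import Data.Maybe as Maybe
open import Data.Maybe.Relation.Binary.Connected using (Connected; just)
open import Data.Product using (Σ; _×_; _,_; proj₁; proj₂)
open import Data.Sum using (_⊎_; inj₁; inj₂; [_,_]′)
open import Relation.Nullary using (¬_; yes; no; contradiction)
open import Relation.Binary using (tri<; tri≈; tri>)
open import Relation.Binary.PropositionalEquality hiding ([_])
open import Function.Base using (_∘_)
open import Function.Bundles using (_⇔_; Equivalence)

module _ {A : Set} where

  head-++ : ∀ (xs ys : List A) {x} → head xs ≡ just x → head (xs ++ ys) ≡ just x
  head-++ (_ ∷ _) ys e = e

  last-++ : ∀ (xs ys : List A) → ys ≢ [] → last (xs ++ ys) ≡ last ys
  last-++ []                ys       ys≢[] = refl
  last-++ (x ∷ [])          []       ys≢[] = contradiction refl ys≢[]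
  last-++ (x ∷ [])          (y ∷ ys) ys≢[] = refl
  last-++ (x ∷ xs@(_ ∷ _))  ys       ys≢[] = last-++ xs ys ys≢[]

  last-∷ʳ : ∀ (xs : List A) w → last (xs ∷ʳ w) ≡ just w
  last-∷ʳ xs w = last-++ xs [ w ] λ ()

  1≤length⇒≢[] : ∀ {xs : List A} → 1 ≤ length xs → xs ≢ []
  1≤length⇒≢[] {_ ∷ _} _ ()

  ≢[]⇒1≤length : ∀ {xs : List A} → xs ≢ [] → 1 ≤ length xs
  ≢[]⇒1≤length {[]}    xs≢[] = contradiction refl xs≢[]
  ≢[]⇒1≤length {_ ∷ _} _     = s≤s z≤n

  ∈-∷-∷ʳ⁻ : ∀ {u w v} (ms : List A) → v ∈ u ∷ (ms ∷ʳ w) → v ≡ u ⊎ v ∈ ms ⊎ v ≡ w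
  ∈-∷-∷ʳ⁻ ms (here e) = inj₁ e
  ∈-∷-∷ʳ⁻ ms (there p) with ∈-++⁻ ms p
  ... | inj₁ q        = inj₂ (inj₁ q)
  ... | inj₂ (here e) = inj₂ (inj₂ e)

  Unique-lookup-injective : ∀ (xs : List A) → Unique xs → ∀ {i j} → lookup xs i ≡ lookup xs j → i ≡ j
  Unique-lookup-injective (x ∷ xs) (x∉ ∷ u) {zero}  {zero}  e = refl
  Unique-lookup-injective (x ∷ xs) (x∉ ∷ u) {zero}  {suc j} e = contradiction e (All.lookup x∉ (∈-lookup j))
  Unique-lookup-injective (x ∷ xs) (x∉ ∷ u) {suc i} {zero}  e = contradiction (sym e) (All.lookup x∉ (∈-lookup i))
  Unique-lookup-injective (x ∷ xs) (x∉ ∷ u) {suc i} {suc j} e = cong suc (Unique-lookup-injective xs u e)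

  module _ {R : A → A → Set} where

    Linked-lookup : ∀ (xs : List A) → Linked R xs → ∀ (i j : Fin (length xs)) →
                    toℕ j ≡ suc (toℕ i) → R (lookup xs i) (lookup xs j)
    Linked-lookup (x ∷ y ∷ xs) (r ∷ _)  zero    (suc zero)    _  = r
    Linked-lookup (x ∷ y ∷ xs) (_ ∷ rs) (suc i) (suc j)       e  = Linked-lookup (y ∷ xs) rs i j (suc-injective e)
    Linked-lookup (x ∷ y ∷ xs) _        zero    (suc (suc j)) ()
    Linked-lookup (x ∷ y ∷ xs) _        zero    zero          ()
    Linked-lookup (x ∷ [])     [-]      zero    zero          ()

    Connected-just : ∀ (xs ys : List A) {u v} → last xs ≡ just u → head ys ≡ just v → R u v →
                     Connected R (last xs) (head ys)
    Connected-just _ _ eu ev r rewrite eu | ev = just r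

  head-lookup : ∀ (xs : List A) (i : Fin (length xs)) → toℕ i ≡ 0 → head xs ≡ just (lookup xs i)
  head-lookup (x ∷ xs) zero _ = refl

  last-lookup : ∀ (xs : List A) (i : Fin (length xs)) → suc (toℕ i) ≡ length xs → last xs ≡ just (lookup xs i)
  last-lookup (x ∷ [])     zero    _ = refl
  last-lookup (x ∷ y ∷ xs) (suc i) e = last-lookup (y ∷ xs) i (suc-injective e)

module _ {A B : Set} (f : A → B) where

  head-map-just : ∀ (xs : List A) {x} → head xs ≡ just x → head (map f xs) ≡ just (f x)
  head-map-just xs e = trans (head-map {f = f} xs) (cong (Maybe.map f) e)

  last-map-just : ∀ (xs : List A) {x} → last xs ≡ just x → last (map f xs) ≡ just (f x)
  last-map-just xs e = trans (last-map f xs) (cong (Maybe.map f) e)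

ascending : ℕ → ℕ → List ℕ
ascending lo zero    = [ lo ]
ascending lo (suc n) = lo ∷ ascending (suc lo) n

descending : ℕ → ℕ → List ℕ
descending lo zero    = [ lo ]
descending lo (suc n) = lo + suc n ∷ descending lo n

ascending-length : ∀ lo n → length (ascending lo n) ≡ suc n
ascending-length lo zero    = refl
ascending-length lo (suc n) = cong suc (ascending-length (suc lo) n)

descending-length : ∀ lo n → length (descending lo n) ≡ suc n
descending-length lo zero    = refl
descending-length lo (suc n) = cong suc (descending-length lo n)

ascending-head : ∀ lo n → head (ascending lo n) ≡ just lo
ascending-head lo zero    = refl
ascending-head lo (suc n) = refl

descending-head : ∀ lo n → head (descending lo n) ≡ just (lo + n)
descending-head lo zero    = cong just (sym (+-identityʳ lo))
descending-head lo (suc n) = refl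

ascending-last : ∀ lo n → last (ascending lo n) ≡ just (lo + n)
ascending-last lo zero          = cong just (sym (+-identityʳ lo))
ascending-last lo (suc zero)    = cong just (sym (+-comm lo 1))
ascending-last lo (suc (suc n)) = trans (ascending-last (suc lo) (suc n)) (cong just (sym (+-suc lo (suc n))))

descending-last : ∀ lo n → last (descending lo n) ≡ just lo
descending-last lo zero          = refl
descending-last lo (suc zero)    = refl
descending-last lo (suc (suc n)) = descending-last lo (suc n)

InRange : ℕ → ℕ → ℕ → Set
InRange lo hi m = lo ≤ m × m ≤ hi

ascending-bounds : ∀ lo n {m} → m ∈ ascending lo n → InRange lo (lo + n) m
ascending-bounds lo zero    (here refl) = ≤-refl , m≤m+n lo 0
ascending-bounds lo (suc n) (here refl) = ≤-refl , m≤m+n lo (suc n)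
ascending-bounds lo (suc n) (there p)   =
  let l , u = ascending-bounds (suc lo) n p in <⇒≤ l , ≤-trans u (≤-reflexive (sym (+-suc lo n)))

descending-bounds : ∀ lo n {m} → m ∈ descending lo n → InRange lo (lo + n) m
descending-bounds lo zero    (here refl) = ≤-refl , m≤m+n lo 0
descending-bounds lo (suc n) (here refl) = m≤m+n lo (suc n) , ≤-refl
descending-bounds lo (suc n) (there p)   =
  let l , u = descending-bounds lo n p in l , ≤-trans u (+-monoʳ-≤ lo (n≤1+n n))

ascending-unique : ∀ lo n → Unique (ascending lo n)
ascending-unique lo zero    = [] ∷ []
ascending-unique lo (suc n) =
  All.tabulate (λ p e → <-irrefl e (proj₁ (ascending-bounds (suc lo) n p))) ∷ ascending-unique (suc lo) n

descending-unique : ∀ lo n → Unique (descending lo n)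
descending-unique lo zero    = [] ∷ []
descending-unique lo (suc n) =
  All.tabulate (λ p e → <-irrefl (sym e) (≤-<-trans (proj₂ (descending-bounds lo n p)) (+-monoʳ-< lo (n<1+n n))))
  ∷ descending-unique lo n

sum-below : ∀ {e e′ σ σ′ d s} → e ≤ σ → e′ + σ′ ≤ s → σ + d ≤ σ′ → e′ + e + d ≤ s
sum-below {e} {e′} {σ} {σ′} {d} {s} e≤σ e′+σ′≤s σ+d≤σ′ = begin
  e′ + e + d    ≡⟨ +-assoc e′ e d ⟩
  e′ + (e + d)  ≤⟨ +-monoʳ-≤ e′ (+-monoˡ-≤ d e≤σ) ⟩
  e′ + (σ + d)  ≤⟨ +-monoʳ-≤ e′ σ+d≤σ′ ⟩
  e′ + σ′       ≤⟨ e′+σ′≤s ⟩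
  s             ∎
  where open ≤-Reasoning

crossing-sum : ∀ {f Z₁ W₁ Z₂ W₂ s₁ s₂} → f + W₂ + Z₂ ≤ s₁ + Z₁ + W₁ → f + Z₁ + W₁ ≤ s₂ + W₂ + Z₂ → f + f ≤ s₁ + s₂
crossing-sum {f} {Z₁} {W₁} {Z₂} {W₂} {s₁} {s₂} h₁ h₂ =
  +-cancelʳ-≤ (Z₁ + W₁ + Z₂ + W₂) (f + f) (s₁ + s₂) (subst₂ _≤_ (lhs f Z₁ W₁ Z₂ W₂) (rhs s₁ s₂ Z₁ W₁ Z₂ W₂) (+-mono-≤ h₁ h₂))
  where
  lhs : ∀ f Z₁ W₁ Z₂ W₂ → f + W₂ + Z₂ + (f + Z₁ + W₁) ≡ f + f + (Z₁ + W₁ + Z₂ + W₂)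
  lhs = solve-∀
  rhs : ∀ s₁ s₂ Z₁ W₁ Z₂ W₂ → s₁ + Z₁ + W₁ + (s₂ + W₂ + Z₂) ≡ s₁ + s₂ + (Z₁ + W₁ + Z₂ + W₂)
  rhs = solve-∀

[p+3]+[p+3]+d≡2p+[d+1]+5 : ∀ p d → p + 3 + (p + 3) + d ≡ 2 * p + (d + 1) + 5
[p+3]+[p+3]+d≡2p+[d+1]+5 = solve-∀

<⇒+1≤ : ∀ {a b} → a < b → a + 1 ≤ b
<⇒+1≤ {a} {b} = subst (_≤ b) (+-comm 1 a)

<-<⇒+2≤ : ∀ {a b c} → a < b → b < c → a + 2 ≤ c
<-<⇒+2≤ {a} {_} {c} a<b b<c = subst (_≤ c) (+-comm 2 a) (≤-trans (s≤s a<b) b<c)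

<-<⇒+2≤+ : ∀ {a b c d} → a < b → c < d → a + c + 2 ≤ b + d
<-<⇒+2≤+ {a} {b} {c} {d} a<b c<d =
  subst (_≤ b + d) (trans (cong suc (+-suc a c)) (+-comm 2 (a + c))) (+-mono-≤ a<b c<d)

module _ {A : Set} (f : A → ℕ) where

  three-values-spread : ∀ {u v w} → f u ≢ f v → f u ≢ f w → f v ≢ f w →
    Σ A λ i → Σ A λ j → i ∈ u ∷ v ∷ [ w ] × j ∈ u ∷ v ∷ [ w ] × f i + 2 ≤ f j
  three-values-spread {u} {v} {w} u≢v u≢w v≢w with <-cmp (f u) (f v) | <-cmp (f v) (f w) | <-cmp (f u) (f w)
  ... | tri< u<v _ _ | tri< v<w _ _ | _            = u , w , here refl , there (there (here refl)) , <-<⇒+2≤ u<v v<w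
  ... | tri> _ _ v<u | tri> _ _ w<v | _            = w , u , there (there (here refl)) , here refl , <-<⇒+2≤ w<v v<u
  ... | tri< u<v _ _ | tri> _ _ w<v | tri< u<w _ _ = u , v , here refl , there (here refl) , <-<⇒+2≤ u<w w<v
  ... | tri< u<v _ _ | tri> _ _ w<v | tri> _ _ w<u = w , v , there (there (here refl)) , there (here refl) , <-<⇒+2≤ w<u u<v
  ... | tri> _ _ v<u | tri< v<w _ _ | tri< u<w _ _ = v , w , there (here refl) , there (there (here refl)) , <-<⇒+2≤ v<u u<w
  ... | tri> _ _ v<u | tri< v<w _ _ | tri> _ _ w<u = v , u , there (here refl) , here refl , <-<⇒+2≤ v<w w<u
  ... | tri≈ _ e _ | _ | _ = contradiction e u≢v
  ... | _ | tri≈ _ e _ | _ = contradiction e v≢w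
  ... | _ | _ | tri≈ _ e _ = contradiction e u≢w

-- Positions on the cycle

module Modular (k : ℕ) .{{_ : NonZero k}} where

  %-injective-window : ∀ m n → m % k ≡ n % k → m < n + k → n < m + k → m ≡ n
  %-injective-window m n e m<n+k n<m+k =
    begin
      m                  ≡⟨ m≡m%n+[m/n]*n m k ⟩
      m % k + m / k * k  ≡⟨ cong₂ (λ r q → r + q * k) e (≤-antisym (quotient-≤ m n e m<n+k) (quotient-≤ n m (sym e) n<m+k)) ⟩
      n % k + n / k * k  ≡⟨ m≡m%n+[m/n]*n n k ⟨
      n                  ∎
    where
    open ≡-Reasoning
    quotient-≤ : ∀ u v → u % k ≡ v % k → u < v + k → u / k ≤ v / k
    quotient-≤ u v e u<v+k = m<1+n⇒m≤n (*-cancelʳ-< k (u / k) (suc (v / k)) (+-cancelˡ-< (u % k) _ _ lt))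
      where
      lt : u % k + u / k * k < u % k + suc (v / k) * k
      lt = subst₂ _<_ (m≡m%n+[m/n]*n u k)
             (trans (cong (λ r → r + v / k * k + k) (sym e))
               (trans (+-assoc (u % k) _ k) (cong (u % k +_) (+-comm (v / k * k) k))))
             (subst (λ t → u < t + k) (m≡m%n+[m/n]*n v k) u<v+k)

  [m%k+n]%k≡[m+n]%k : ∀ m n → (m % k + n) % k ≡ (m + n) % k
  [m%k+n]%k≡[m+n]%k m n = begin
    (m % k + n) % k          ≡⟨ %-distribˡ-+ (m % k) n k ⟩
    (m % k % k + n % k) % k  ≡⟨ cong (λ r → (r + n % k) % k) (m%n%n≡m%n m k) ⟩
    (m % k + n % k) % k      ≡⟨ %-distribˡ-+ m n k ⟨
    (m + n) % k              ∎
    where open ≡-Reasoning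

  fdist<k : ∀ (a j : Fin k) → fdist a j < k
  fdist<k a j with toℕ a ≤? toℕ j
  ... | yes _   = ≤-<-trans (m∸n≤m (toℕ j) (toℕ a)) (toℕ<n j)
  ... | no a≰j  = subst (k + toℕ j ∸ toℕ a <_) (m+n∸n≡m k (toℕ a))
                    (∸-monoˡ-< (+-monoʳ-< k (≰⇒> a≰j)) (≤-trans (<⇒≤ (toℕ<n a)) (m≤m+n k (toℕ j))))

  fdist-correct : ∀ (a j : Fin k) → (toℕ a + fdist a j) % k ≡ toℕ j
  fdist-correct a j with toℕ a ≤? toℕ j
  ... | yes a≤j = trans (cong (_% k) (m+[n∸m]≡n a≤j)) (m<n⇒m%n≡m (toℕ<n j))
  ... | no a≰j  = begin
    (toℕ a + (k + toℕ j ∸ toℕ a)) % k  ≡⟨ cong (_% k) (m+[n∸m]≡n (≤-trans (<⇒≤ (toℕ<n a)) (m≤m+n k (toℕ j)))) ⟩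
    (k + toℕ j) % k                    ≡⟨ cong (_% k) (+-comm k (toℕ j)) ⟩
    (toℕ j + k) % k                    ≡⟨ [m+n]%n≡m%n (toℕ j) k ⟩
    toℕ j % k                          ≡⟨ m<n⇒m%n≡m (toℕ<n j) ⟩
    toℕ j                              ∎
    where open ≡-Reasoning

  fdist-unique : ∀ (a j : Fin k) d → d < k → (toℕ a + d) % k ≡ toℕ j → fdist a j ≡ d
  fdist-unique a j d d<k e = sym (+-cancelˡ-≡ (toℕ a) _ _
    (%-injective-window (toℕ a + d) (toℕ a + fdist a j) (trans e (sym (fdist-correct a j)))
      (shifted d<k (fdist a j)) (shifted (fdist<k a j) d)))
    where
    shifted : ∀ {u} → u < k → ∀ v → toℕ a + u < toℕ a + v + k
    shifted {u} u<k v = subst (toℕ a + u <_) (sym (+-assoc (toℕ a) v k)) (+-monoʳ-< (toℕ a) (<-≤-trans u<k (m≤n+m k v)))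

  fdist-injective : ∀ (a : Fin k) {j j′} → fdist a j ≡ fdist a j′ → j ≡ j′
  fdist-injective a {j} {j′} e =
    toℕ-injective (trans (sym (fdist-correct a j)) (trans (cong (λ d → (toℕ a + d) % k) e) (fdist-correct a j′)))

  fdist-self : ∀ (a : Fin k) → fdist a a ≡ 0
  fdist-self a = fdist-unique a a 0 (<-≤-trans (s≤s z≤n) (toℕ<n a))
                   (trans (cong (_% k) (+-identityʳ (toℕ a))) (m<n⇒m%n≡m (toℕ<n a)))

  fdist-positive : ∀ {a j : Fin k} → a ≢ j → 0 < fdist a j
  fdist-positive {a} {j} a≢j with fdist a j in e
  ... | suc _ = s≤s z≤n
  ... | zero  = contradiction (fdist-injective a (trans (fdist-self a) (sym e))) a≢j

  fdist-round-trip : ∀ {a a′ : Fin k} → a ≢ a′ → fdist a a′ + fdist a′ a ≡ k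
  fdist-round-trip {a} {a′} a≢a′ = +-cancelˡ-≡ (toℕ a) _ _
    (%-injective-window _ _ same-residue
      (subst (toℕ a + (d + d′) <_) (sym (+-assoc (toℕ a) k k)) (+-monoʳ-< (toℕ a) (+-mono-< (fdist<k a a′) (fdist<k a′ a))))
      (subst (toℕ a + k <_) (sym (+-assoc (toℕ a) (d + d′) k))
        (+-monoʳ-< (toℕ a) (+-monoˡ-< k (≤-trans (fdist-positive a≢a′) (m≤m+n d d′))))))
    where
    d d′ : ℕ
    d = fdist a a′
    d′ = fdist a′ a
    open ≡-Reasoning
    same-residue : (toℕ a + (d + d′)) % k ≡ (toℕ a + k) % k
    same-residue = begin
      (toℕ a + (d + d′)) % k        ≡⟨ cong (_% k) (+-assoc (toℕ a) d d′) ⟨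
      (toℕ a + d + d′) % k          ≡⟨ [m%k+n]%k≡[m+n]%k (toℕ a + d) d′ ⟨
      ((toℕ a + d) % k + d′) % k    ≡⟨ cong (λ r → (r + d′) % k) (fdist-correct a a′) ⟩
      (toℕ a′ + d′) % k             ≡⟨ fdist-correct a′ a ⟩
      toℕ a                         ≡⟨ m<n⇒m%n≡m (toℕ<n a) ⟨
      toℕ a % k                     ≡⟨ [m+n]%n≡m%n (toℕ a) k ⟨
      (toℕ a + k) % k               ∎

fdist≡1⇒successor : ∀ {n} (i j : Fin n) → fdist i j ≡ 1 →
                    toℕ j ≡ suc (toℕ i) ⊎ (toℕ j ≡ 0 × suc (toℕ i) ≡ n)
fdist≡1⇒successor {n} i j e with toℕ i ≤? toℕ j
... | yes i≤j = inj₁ (trans (sym (m+[n∸m]≡n i≤j)) (trans (+-comm (toℕ i) _) (cong (_+ toℕ i) e)))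
... | no i≰j  = inj₂ (j≡0 , trans (sym wraps) (trans (cong (n +_) j≡0) (+-identityʳ n)))
  where
  wraps : n + toℕ j ≡ suc (toℕ i)
  wraps = trans (sym (m∸n+n≡m (≤-trans (<⇒≤ (toℕ<n i)) (m≤m+n n (toℕ j))))) (cong (_+ toℕ i) e)
  j≡0 : toℕ j ≡ 0
  j≡0 = n≤0⇒n≡0 (+-cancelˡ-≤ n (toℕ j) 0
          (subst (n + toℕ j ≤_) (sym (+-identityʳ n)) (subst (_≤ n) (sym wraps) (toℕ<n i))))

module _ (G : Graph) {k} {c : Fin k → Graph.Vertex G} (longest : IsLongestCycle G c) where
  open Graph G using (Vertex; Adj)

  cycle-length-bound : ∀ (V : List Vertex) → Unique V → Linked Adj V → 3 ≤ length V →
                       ∀ {h l} → head V ≡ just h → last V ≡ just l → Adj l h → length V ≤ k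
  cycle-length-bound V unique linked 3≤ eh el closing =
    proj₂ longest (length V) (lookup V) (3≤ , Unique-lookup-injective V unique , successor-adjacent)
    where
    successor-adjacent : ∀ i j → fdist i j ≡ 1 → Adj (lookup V i) (lookup V j)
    successor-adjacent i j e with fdist≡1⇒successor i j e
    ... | inj₁ j≡1+i = Linked-lookup V linked i j j≡1+i
    ... | inj₂ (j≡0 , 1+i≡n)
      with trans (sym (last-lookup V i 1+i≡n)) el | trans (sym (head-lookup V j j≡0)) eh
    ... | refl | refl = closing

module Unrolled (G : Graph) {k} {c : Fin k → Graph.Vertex G} (cycle : IsCycle G c) (a : Fin k) where
  open Graph G using (Vertex; Adj) renaming (sym to Adj-sym)

  private
    instance
      k-nonZero : NonZero k
      k-nonZero = >-nonZero (≤-trans (s≤s z≤n) (proj₁ cycle))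

  open Modular k

  -- at n is the vertex n steps after c a along C; it is k-periodic and injective on every window
  -- of k consecutive offsets.
  position : ℕ → Fin k
  position n = fromℕ< (m%n<n (toℕ a + n) k)

  at : ℕ → Vertex
  at n = c (position n)

  at≡c : ∀ n {j} → (toℕ a + n) % k ≡ toℕ j → at n ≡ c j
  at≡c n e = cong c (toℕ-injective (trans (toℕ-fromℕ< _) e))

  c≡at-fdist : ∀ j → c j ≡ at (fdist a j)
  c≡at-fdist j = sym (at≡c _ (fdist-correct a j))

  c≡at-fdist-via : ∀ a′ j → c j ≡ at (fdist a a′ + fdist a′ j)
  c≡at-fdist-via a′ j = sym (at≡c _ (begin
    (toℕ a + (fdist a a′ + fdist a′ j)) % k      ≡⟨ cong (_% k) (+-assoc (toℕ a) _ _) ⟨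
    (toℕ a + fdist a a′ + fdist a′ j) % k        ≡⟨ [m%k+n]%k≡[m+n]%k (toℕ a + fdist a a′) _ ⟨
    ((toℕ a + fdist a a′) % k + fdist a′ j) % k  ≡⟨ cong (λ r → (r + fdist a′ j) % k) (fdist-correct a a′) ⟩
    (toℕ a′ + fdist a′ j) % k                    ≡⟨ fdist-correct a′ j ⟩
    toℕ j                                        ∎))
    where open ≡-Reasoning

  at-adjacent : ∀ n → Adj (at n) (at (suc n))
  at-adjacent n = proj₂ (proj₂ cycle) _ _ (fdist-unique _ _ 1 (≤-trans (s≤s (s≤s z≤n)) (proj₁ cycle)) (begin
    (toℕ (position n) + 1) % k  ≡⟨ cong (λ r → (r + 1) % k) (toℕ-fromℕ< _) ⟩
    ((toℕ a + n) % k + 1) % k   ≡⟨ [m%k+n]%k≡[m+n]%k (toℕ a + n) 1 ⟩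
    (toℕ a + n + 1) % k         ≡⟨ cong (_% k) (trans (+-assoc (toℕ a) n 1) (cong (toℕ a +_) (+-comm n 1))) ⟩
    (toℕ a + suc n) % k         ≡⟨ toℕ-fromℕ< _ ⟨
    toℕ (position (suc n))      ∎))
    where open ≡-Reasoning

  at-periodic : ∀ n → at (k + n) ≡ at n
  at-periodic n = at≡c (k + n) (begin
    (toℕ a + (k + n)) % k  ≡⟨ cong (_% k) (trans (cong (toℕ a +_) (+-comm k n)) (sym (+-assoc (toℕ a) n k))) ⟩
    (toℕ a + n + k) % k    ≡⟨ [m+n]%n≡m%n (toℕ a + n) k ⟩
    (toℕ a + n) % k        ≡⟨ toℕ-fromℕ< _ ⟨
    toℕ (position n)       ∎)
    where open ≡-Reasoning

  at-k≡c-start : at k ≡ c a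
  at-k≡c-start = begin
    at k              ≡⟨ cong at (+-identityʳ k) ⟨
    at (k + 0)        ≡⟨ at-periodic 0 ⟩
    at 0              ≡⟨ cong at (fdist-self a) ⟨
    at (fdist a a)    ≡⟨ c≡at-fdist a ⟨
    c a               ∎
    where open ≡-Reasoning

  Window : ℕ → ℕ → Set
  Window lo m = lo ≤ m × m < lo + k

  at-injective : ∀ lo {m n} → Window lo m → Window lo n → at m ≡ at n → m ≡ n
  at-injective lo {m} {n} (lo≤m , m<) (lo≤n , n<) e = +-cancelˡ-≡ (toℕ a) _ _
    (%-injective-window _ _ same-residue (shift (<-≤-trans m< (+-monoˡ-≤ k lo≤n))) (shift (<-≤-trans n< (+-monoˡ-≤ k lo≤m))))
    where
    same-residue : (toℕ a + m) % k ≡ (toℕ a + n) % k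
    same-residue = trans (sym (toℕ-fromℕ< _)) (trans (cong toℕ (proj₁ (proj₂ cycle) e)) (toℕ-fromℕ< _))
    shift : ∀ {u v} → u < v + k → toℕ a + u < toℕ a + v + k
    shift {u} {v} lt = subst (toℕ a + u <_) (sym (+-assoc (toℕ a) v k)) (+-monoʳ-< (toℕ a) lt)

-- Cycles through P

initial-arcs-arithmetic : ∀ {L m Z W′ d₁ d₂ k} → suc (suc Z + d₁ + W′) + d₂ ≡ k →
  L + (suc d₁ + (m + 2 + suc d₂)) ≤ k → L + m + 2 ≤ Z + W′
initial-arcs-arithmetic {L} {m} {Z} {W′} {d₁} {d₂} refl h =
  +-cancelʳ-≤ (2 + d₁ + d₂) (L + m + 2) (Z + W′) (subst₂ _≤_ (lhs L m d₁ d₂) (rhs Z W′ d₁ d₂) h)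
  where
  lhs : ∀ L m d₁ d₂ → L + (suc d₁ + (m + 2 + suc d₂)) ≡ L + m + 2 + (2 + d₁ + d₂)
  lhs = solve-∀
  rhs : ∀ Z W′ d₁ d₂ → suc (suc Z + d₁ + W′) + d₂ ≡ Z + W′ + (2 + d₁ + d₂)
  rhs = solve-∀

final-arcs-arithmetic : ∀ {L m k Z₀ W₀ A T B d₁ d₂} → A + T + d₁ ≡ k + Z₀ → B + d₂ ≡ A + W₀ →
  L + (suc d₁ + (m + 2 + suc d₂)) ≤ k → L + m + 2 + suc Z₀ + suc W₀ ≤ B + T
final-arcs-arithmetic {L} {m} {k} {Z₀} {W₀} {A} {T} {B} {d₁} {d₂} e₁ e₂ h =
  +-cancelʳ-≤ (k + A) (L + m + 2 + suc Z₀ + suc W₀) (B + T) (subst₂ _≤_ lhs (rhs k A T B) (+-monoˡ-≤ (A + T + B) h))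
  where
  open ≡-Reasoning
  regroup : ∀ L m d₁ d₂ A T B → L + (suc d₁ + (m + 2 + suc d₂)) + (A + T + B) ≡ L + m + 4 + (A + T + d₁) + (B + d₂)
  regroup = solve-∀
  regroup′ : ∀ L m k Z₀ A W₀ → L + m + 4 + (k + Z₀) + (A + W₀) ≡ L + m + 2 + suc Z₀ + suc W₀ + (k + A)
  regroup′ = solve-∀
  lhs : L + (suc d₁ + (m + 2 + suc d₂)) + (A + T + B) ≡ L + m + 2 + suc Z₀ + suc W₀ + (k + A)
  lhs = begin
    L + (suc d₁ + (m + 2 + suc d₂)) + (A + T + B)  ≡⟨ regroup L m d₁ d₂ A T B ⟩
    L + m + 4 + (A + T + d₁) + (B + d₂)            ≡⟨ cong₂ (λ u v → L + m + 4 + u + v) e₁ e₂ ⟩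
    L + m + 4 + (k + Z₀) + (A + W₀)                ≡⟨ regroup′ L m k Z₀ A W₀ ⟩
    L + m + 2 + suc Z₀ + suc W₀ + (k + A)          ∎
  rhs : ∀ k A T B → k + (A + T + B) ≡ B + T + (k + A)
  rhs = solve-∀

crossing-arithmetic : ∀ {L k U₁ n₁ B n₂ A V₂ V₁ n₃} → B + n₂ ≡ A + V₂ → A + V₁ + n₃ ≡ k →
  L + (suc n₂ + (suc n₁ + suc n₃)) ≤ k → L + 3 + V₂ + (U₁ + n₁) ≤ B + U₁ + V₁
crossing-arithmetic {L} {_} {U₁} {n₁} {B} {n₂} {A} {V₂} {V₁} {n₃} e refl h =
  +-cancelʳ-≤ (A + n₃) (L + 3 + V₂ + (U₁ + n₁)) (B + U₁ + V₁) (subst₂ _≤_ lhs (rhs A V₁ n₃ B U₁) (+-monoˡ-≤ (B + U₁) h))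
  where
  open ≡-Reasoning
  regroup : ∀ L n₁ n₂ n₃ B U₁ → L + (suc n₂ + (suc n₁ + suc n₃)) + (B + U₁) ≡ L + 3 + (B + n₂) + (U₁ + n₁) + n₃
  regroup = solve-∀
  regroup′ : ∀ L A V₂ U₂ n₃ → L + 3 + (A + V₂) + U₂ + n₃ ≡ L + 3 + V₂ + U₂ + (A + n₃)
  regroup′ = solve-∀
  lhs : L + (suc n₂ + (suc n₁ + suc n₃)) + (B + U₁) ≡ L + 3 + V₂ + (U₁ + n₁) + (A + n₃)
  lhs = begin
    L + (suc n₂ + (suc n₁ + suc n₃)) + (B + U₁)  ≡⟨ regroup L n₁ n₂ n₃ B U₁ ⟩
    L + 3 + (B + n₂) + (U₁ + n₁) + n₃            ≡⟨ cong (λ t → L + 3 + t + (U₁ + n₁) + n₃) e ⟩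
    L + 3 + (A + V₂) + (U₁ + n₁) + n₃            ≡⟨ regroup′ L A V₂ (U₁ + n₁) n₃ ⟩
    L + 3 + V₂ + (U₁ + n₁) + (A + n₃)            ∎
  rhs : ∀ A V₁ n₃ B U₁ → A + V₁ + n₃ + (B + U₁) ≡ B + U₁ + V₁ + (A + n₃)
  rhs = solve-∀

module CyclesThroughPath (G : Graph) {k} {c : Fin k → Graph.Vertex G} (longest : IsLongestCycle G c) (a : Fin k)
    {P : List (Graph.Vertex G)} {x y : Graph.Vertex G} (pathP : IsPath G P) (P-avoids : AvoidsCycle G c P)
    (headP : head P ≡ just x) (lastP : last P ≡ just y) where
  open Graph G using (Vertex; Adj) renaming (sym to Adj-sym)
  open Unrolled G (proj₁ longest) a public

  AdjAt : ℕ → ℕ → Set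
  AdjAt m n = Adj (at m) (at n)

  ascending-linked : ∀ lo n → Linked AdjAt (ascending lo n)
  ascending-linked lo zero          = [-]
  ascending-linked lo (suc zero)    = at-adjacent lo ∷ [-]
  ascending-linked lo (suc (suc n)) = at-adjacent lo ∷ ascending-linked (suc lo) (suc n)

  descending-linked : ∀ lo n → Linked AdjAt (descending lo n)
  descending-linked lo zero          = [-]
  descending-linked lo (suc zero)    =
    subst (λ t → AdjAt t lo) (+-comm 1 lo) (Adj-sym (at-adjacent lo)) ∷ [-]
  descending-linked lo (suc (suc n)) =
    subst (λ t → AdjAt t (lo + suc n)) (sym (+-suc lo (suc n))) (Adj-sym (at-adjacent (lo + suc n)))
    ∷ descending-linked lo (suc n)

  -- A run of consecutive offsets, walked forwards or backwards, inside the window [lo, lo + k).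
  record Arc (lo : ℕ) : Set where
    field
      positions              : List ℕ
      start end lower upper  : ℕ
      unique                 : Unique positions
      linked                 : Linked AdjAt positions
      head≡start             : head positions ≡ just start
      last≡end               : last positions ≡ just end
      bounded                : ∀ {m} → m ∈ positions → InRange lower upper m
      lo≤lower               : lo ≤ lower
      upper<lo+k             : upper < lo + k

    vertices : List Vertex
    vertices = map at positions

    inWindow : ∀ {m} → m ∈ positions → Window lo m
    inWindow p = let l , u = bounded p in ≤-trans lo≤lower l , ≤-<-trans u upper<lo+k

  open Arc using (positions; start; end; lower; upper; bounded; vertices; inWindow)

  ascendingArc : ∀ {lo} from n → lo ≤ from → from + n < lo + k → Arc lo
  ascendingArc from n lo≤ <lo+k = record
    { positions = ascending from n ; start = from ; end = from + n ; lower = from ; upper = from + n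
    ; unique = ascending-unique from n ; linked = ascending-linked from n
    ; head≡start = ascending-head from n ; last≡end = ascending-last from n
    ; bounded = ascending-bounds from n ; lo≤lower = lo≤ ; upper<lo+k = <lo+k }

  descendingArc : ∀ {lo} from n → lo ≤ from → from + n < lo + k → Arc lo
  descendingArc from n lo≤ <lo+k = record
    { positions = descending from n ; start = from + n ; end = from ; lower = from ; upper = from + n
    ; unique = descending-unique from n ; linked = descending-linked from n
    ; head≡start = descending-head from n ; last≡end = descending-last from n
    ; bounded = descending-bounds from n ; lo≤lower = lo≤ ; upper<lo+k = <lo+k }

  Outside : ∀ {lo} → ℕ → Arc lo → Set
  Outside z O = z < lower O ⊎ upper O < z

  Apart : ∀ {lo} → Arc lo → Arc lo → Set
  Apart O O′ = upper O < lower O′ ⊎ upper O′ < lower O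

  module _ {lo : ℕ} where

    vertices-unique : ∀ (O : Arc lo) → Unique (vertices O)
    vertices-unique O = go (positions O) (Arc.unique O) (inWindow O)
      where
      go : ∀ ms → Unique ms → (∀ {m} → m ∈ ms → Window lo m) → Unique (map at ms)
      go []       _         _   = []
      go (m ∷ ms) (m∉ ∷ u) win = All.tabulate fresh ∷ go ms u (win ∘ there)
        where
        fresh : ∀ {v} → v ∈ map at ms → at m ≢ v
        fresh p e with ∈-map⁻ at p
        ... | m′ , m′∈ , refl = All.lookup m∉ m′∈ (at-injective lo (win (here refl)) (win (there m′∈)) e)

    at∉vertices : ∀ (O : Arc lo) {z} → Window lo z → Outside z O → at z ∉ vertices O
    at∉vertices O {z} wz out p with ∈-map⁻ at p
    ... | m , m∈ , e with at-injective lo wz (inWindow O m∈) e | bounded O m∈ | out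
    ...   | refl | l , _ | inj₁ z<lower = <⇒≱ z<lower l
    ...   | refl | _ , u | inj₂ upper<z = <⇒≱ upper<z u

    vertices-disjoint : ∀ (O O′ : Arc lo) → Apart O O′ → ∀ {v} → ¬ (v ∈ vertices O × v ∈ vertices O′)
    vertices-disjoint O O′ apart (p , p′) with ∈-map⁻ at p | ∈-map⁻ at p′
    ... | m , m∈ , refl | m′ , m′∈ , e with at-injective lo (inWindow O m∈) (inWindow O′ m′∈) e | apart
    ...   | refl | inj₁ O<O′ = <⇒≱ O<O′ (≤-trans (proj₁ (bounded O′ m′∈)) (proj₂ (bounded O m∈)))
    ...   | refl | inj₂ O′<O = <⇒≱ O′<O (≤-trans (proj₁ (bounded O m∈)) (proj₂ (bounded O′ m′∈)))

    vertices-head : ∀ (O : Arc lo) → head (vertices O) ≡ just (at (start O))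
    vertices-head O = head-map-just at (positions O) (Arc.head≡start O)

    vertices-last : ∀ (O : Arc lo) → last (vertices O) ≡ just (at (end O))
    vertices-last O = last-map-just at (positions O) (Arc.last≡end O)

    vertices≢[] : ∀ (O : Arc lo) → vertices O ≢ []
    vertices≢[] O with positions O | Arc.head≡start O
    ... | _ ∷ _ | _ = λ ()

  OffCycleAndPath : Vertex → Set
  OffCycleAndPath v = (∀ i → v ≢ c i) × v ∉ P

  at∉P : ∀ n → at n ∉ P
  at∉P n = P-avoids (position n)

  vertices∉P : ∀ {lo} (O : Arc lo) {v} → v ∈ vertices O → v ∉ P
  vertices∉P O p with ∈-map⁻ at p
  ... | m , _ , refl = at∉P m

  cycle-through-P : ∀ (Q : List Vertex) → Unique Q → Linked Adj Q → (∀ {v} → v ∈ Q → v ∉ P) → 2 ≤ length Q →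
                    ∀ {h l} → head Q ≡ just h → last Q ≡ just l → Adj y h → Adj l x → length P + length Q ≤ k
  cycle-through-P Q unique-Q linked-Q Q∉P 2≤ hQ lQ yh lx =
    subst (_≤ k) (length-++ P)
      (cycle-length-bound G longest (P ++ Q) unique linked three (head-++ P Q headP) (trans (last-++ P Q Q≢[]) lQ) lx)
    where
    Q≢[] : Q ≢ []
    Q≢[] = 1≤length⇒≢[] (≤-trans (s≤s z≤n) 2≤)
    unique : Unique (P ++ Q)
    unique = Unique.++⁺ (proj₁ (proj₂ pathP)) unique-Q (λ (p , q) → Q∉P q p)
    linked : Linked Adj (P ++ Q)
    linked = Linked.++⁺ (proj₂ (proj₂ pathP)) (Connected-just P Q lastP hQ yh) linked-Q
    three : 3 ≤ length (P ++ Q)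
    three = subst (3 ≤_) (sym (length-++ P)) (+-mono-≤ (≢[]⇒1≤length (proj₁ pathP)) 2≤)

  cycle-via-path : ∀ {lo} (O₁ O₂ : Arc lo) {z w} {ms : List Vertex} →
    IsPath G (at z ∷ ms ∷ʳ at w) → All OffCycleAndPath ms → Window lo z → Window lo w →
    Outside z O₁ → Outside w O₁ → Outside z O₂ → Outside w O₂ → Apart O₁ O₂ →
    AdjAt (end O₁) z → AdjAt w (start O₂) → Adj y (at (start O₁)) → Adj (at (end O₂)) x →
    length P + (length (positions O₁) + (length ms + 2 + length (positions O₂))) ≤ k
  cycle-via-path {lo} O₁ O₂ {z} {w} {ms} pathM off wz ww z∉₁ w∉₁ z∉₂ w∉₂ apart r₁ r₂ yh lx =
    subst (λ t → length P + t ≤ k) length-Q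
      (cycle-through-P Q unique linked Q∉P two (head-++ (vertices O₁) _ (vertices-head O₁)) last-Q yh lx)
    where
    M = at z ∷ ms ∷ʳ at w
    Q = vertices O₁ ++ M ++ vertices O₂

    length-Q : length Q ≡ length (positions O₁) + (length ms + 2 + length (positions O₂))
    length-Q = begin
      length Q                                              ≡⟨ length-++ (vertices O₁) ⟩
      length (vertices O₁) + length (M ++ vertices O₂)      ≡⟨ cong₂ _+_ (length-map at (positions O₁)) (length-++ M) ⟩
      length (positions O₁) + (length M + length (vertices O₂))
        ≡⟨ cong (λ t → length (positions O₁) + (t + length (vertices O₂)))
                (trans (cong suc (length-++ ms)) (sym (+-suc (length ms) 1))) ⟩
      length (positions O₁) + (length ms + 2 + length (vertices O₂))
        ≡⟨ cong (λ t → length (positions O₁) + (length ms + 2 + t)) (length-map at (positions O₂)) ⟩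
      length (positions O₁) + (length ms + 2 + length (positions O₂)) ∎
      where open ≡-Reasoning

    two : 2 ≤ length Q
    two = subst (2 ≤_) (sym length-Q)
            (≤-trans (≤-trans (m≤n+m 2 (length ms)) (m≤m+n _ _)) (m≤n+m _ (length (positions O₁))))

    M∩O : ∀ (O : Arc lo) → Outside z O → Outside w O → ∀ {v} → ¬ (v ∈ M × v ∈ vertices O)
    M∩O O z∉ w∉ (p , q) with ∈-∷-∷ʳ⁻ ms p
    ... | inj₁ refl        = at∉vertices O wz z∉ q
    ... | inj₂ (inj₂ refl) = at∉vertices O ww w∉ q
    ... | inj₂ (inj₁ r) with ∈-map⁻ at q
    ...   | m , _ , e = proj₁ (All.lookup off r) (position m) e

    unique : Unique Q
    unique = Unique.++⁺ (vertices-unique O₁)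
               (Unique.++⁺ (proj₁ (proj₂ pathM)) (vertices-unique O₂) (M∩O O₂ z∉₂ w∉₂))
               λ (p , q) → [ (λ q₁ → M∩O O₁ z∉₁ w∉₁ (q₁ , p)) , (λ q₂ → vertices-disjoint O₁ O₂ apart (p , q₂)) ]′
                             (∈-++⁻ M q)

    linked : Linked Adj Q
    linked = Linked.++⁺ (Linked.map⁺ (Arc.linked O₁))
               (Connected-just (vertices O₁) (M ++ vertices O₂) (vertices-last O₁) refl r₁)
               (Linked.++⁺ (proj₂ (proj₂ pathM))
                 (Connected-just M (vertices O₂) (last-∷ʳ (at z ∷ ms) (at w)) (vertices-head O₂) r₂)
                 (Linked.map⁺ (Arc.linked O₂)))

    Q∉P : ∀ {v} → v ∈ Q → v ∉ P
    Q∉P q with ∈-++⁻ (vertices O₁) q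
    ... | inj₁ q₁ = vertices∉P O₁ q₁
    ... | inj₂ q′ with ∈-++⁻ M q′
    ...   | inj₂ q₂ = vertices∉P O₂ q₂
    ...   | inj₁ qM with ∈-∷-∷ʳ⁻ ms qM
    ...     | inj₁ refl        = at∉P z
    ...     | inj₂ (inj₁ r)    = proj₂ (All.lookup off r)
    ...     | inj₂ (inj₂ refl) = at∉P w

    last-Q : last Q ≡ just (at (end O₂))
    last-Q = trans (last-++ (vertices O₁) (M ++ vertices O₂) λ ())
               (trans (last-++ M (vertices O₂) (vertices≢[] O₂)) (vertices-last O₂))

  cycle-via-arcs : ∀ {lo} (O₁ O₂ O₃ : Arc lo) → Apart O₁ O₂ → Apart O₁ O₃ → Apart O₂ O₃ →
    AdjAt (end O₁) (start O₂) → AdjAt (end O₂) (start O₃) → Adj y (at (start O₁)) → Adj (at (end O₃)) x →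
    length P + (length (positions O₁) + (length (positions O₂) + length (positions O₃))) ≤ k
  cycle-via-arcs O₁ O₂ O₃ apart₁₂ apart₁₃ apart₂₃ r₁₂ r₂₃ yh lx =
    subst (λ t → length P + t ≤ k) length-Q
      (cycle-through-P Q unique linked Q∉P two (head-++ (vertices O₁) _ (vertices-head O₁)) last-Q yh lx)
    where
    Q = vertices O₁ ++ vertices O₂ ++ vertices O₃

    length-Q : length Q ≡ length (positions O₁) + (length (positions O₂) + length (positions O₃))
    length-Q = trans (length-++ (vertices O₁))
                 (cong₂ _+_ (length-map at (positions O₁))
                   (trans (length-++ (vertices O₂)) (cong₂ _+_ (length-map at (positions O₂)) (length-map at (positions O₃)))))

    two : 2 ≤ length Q
    two = subst (2 ≤_) (sym (length-++ (vertices O₁)))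
            (+-mono-≤ (≢[]⇒1≤length (vertices≢[] O₁))
              (≤-trans (≢[]⇒1≤length (vertices≢[] O₂)) (subst (_ ≤_) (sym (length-++ (vertices O₂))) (m≤m+n _ _))))

    unique : Unique Q
    unique = Unique.++⁺ (vertices-unique O₁)
               (Unique.++⁺ (vertices-unique O₂) (vertices-unique O₃) (vertices-disjoint O₂ O₃ apart₂₃))
               λ (p , q) → [ (λ q₂ → vertices-disjoint O₁ O₂ apart₁₂ (p , q₂))
                           , (λ q₃ → vertices-disjoint O₁ O₃ apart₁₃ (p , q₃)) ]′ (∈-++⁻ (vertices O₂) q)

    linked : Linked Adj Q
    linked = Linked.++⁺ (Linked.map⁺ (Arc.linked O₁))
               (Connected-just (vertices O₁) (vertices O₂ ++ vertices O₃) (vertices-last O₁)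
                 (head-++ (vertices O₂) _ (vertices-head O₂)) r₁₂)
               (Linked.++⁺ (Linked.map⁺ (Arc.linked O₂))
                 (Connected-just (vertices O₂) (vertices O₃) (vertices-last O₂) (vertices-head O₃) r₂₃)
                 (Linked.map⁺ (Arc.linked O₃)))

    Q∉P : ∀ {v} → v ∈ Q → v ∉ P
    Q∉P q with ∈-++⁻ (vertices O₁) q
    ... | inj₁ q₁ = vertices∉P O₁ q₁
    ... | inj₂ q′ = [ vertices∉P O₂ , vertices∉P O₃ ]′ (∈-++⁻ (vertices O₂) q′)

    last-Q : last Q ≡ just (at (end O₃))
    last-Q = trans (last-++ (vertices O₁) (vertices O₂ ++ vertices O₃)
                     (vertices≢[] O₂ ∘ ++-conicalˡ (vertices O₂) (vertices O₃)))
               (trans (last-++ (vertices O₂) (vertices O₃) (vertices≢[] O₃)) (vertices-last O₃))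

  -- The cycle P, at A back along C to at Z, the path, at (A + W′) forward along C to at k = c a.
  initial-arcs-bound : ∀ {Z A W′} {ms : List Vertex} → 0 < Z → Z < A → 0 < W′ → A + W′ < k →
    Adj y (at A) → Adj (at k) x → IsPath G (at Z ∷ ms ∷ʳ at (A + W′)) → All OffCycleAndPath ms →
    length P + length ms + 2 ≤ Z + W′
  initial-arcs-bound {Z} {A} {W′} {ms} 0<Z Z<A 0<W′ W<k yA kx pathM off
    with m≤n⇒∃[o]m+o≡n Z<A | m≤n⇒∃[o]m+o≡n W<k
  ... | d₁ , refl | d₂ , W+d₂≡k = initial-arcs-arithmetic {Z = Z} {W′} {d₁} {d₂} W+d₂≡k
    (subst₂ (λ m n → length P + (m + (length ms + 2 + n)) ≤ k)
      (descending-length (suc Z) d₁) (ascending-length (suc W) d₂)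
      (cycle-via-path O₁ O₂ {Z} {W} pathM off (0<Z , <-trans Z<1+Z+d₁ (<-trans A<W W<1+k)) (s≤s z≤n , W<1+k)
        (inj₁ (n<1+n Z)) (inj₂ A<W) (inj₁ (<-trans Z<1+Z+d₁ A<1+W)) (inj₁ (n<1+n W)) (inj₁ A<1+W)
        (Adj-sym (at-adjacent Z)) (at-adjacent W) yA (subst (λ t → Adj (at t) x) (sym W+d₂≡k) kx)))
    where
    W : ℕ
    W = suc Z + d₁ + W′
    Z<1+Z+d₁ : Z < suc Z + d₁
    Z<1+Z+d₁ = s≤s (m≤m+n Z d₁)
    A<W : suc Z + d₁ < W
    A<W = m<m+n _ 0<W′
    A<1+W : suc Z + d₁ < suc W
    A<1+W = <-trans A<W (n<1+n W)
    W<1+k : W < 1 + k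
    W<1+k = <-trans W<k (n<1+n k)
    O₁ O₂ : Arc 1
    O₁ = descendingArc (suc Z) d₁ (s≤s z≤n) (<-trans A<W W<1+k)
    O₂ = ascendingArc (suc W) d₂ (s≤s z≤n) (≤-<-trans (≤-reflexive W+d₂≡k) (n<1+n k))

  -- The cycle P, at (A + T) forward along C to at (k + Z) = at Z, the path, at (A + W′) back along C
  -- to at B.
  final-arcs-bound : ∀ {Z B A T W′} {ms : List Vertex} → 0 < Z → Z < B → B ≤ A → 0 < W′ → W′ < T → A + T ≤ k →
    Adj y (at (A + T)) → Adj (at B) x → IsPath G (at Z ∷ ms ∷ʳ at (A + W′)) → All OffCycleAndPath ms →
    length P + length ms + 2 + Z + W′ ≤ B + T
  final-arcs-bound {suc Z₀} {B} {A} {T} {suc W₀} {ms} _ Z<B B≤A _ W′<T A+T≤k yh lx pathM off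
    with m≤n⇒∃[o]m+o≡n (≤-trans A+T≤k (m≤m+n k Z₀)) | m≤n⇒∃[o]m+o≡n (≤-trans B≤A (m≤m+n A W₀))
  ... | d₁ , e₁ | d₂ , e₂ = final-arcs-arithmetic e₁ e₂
    (subst₂ (λ m n → length P + (m + (length ms + 2 + n)) ≤ k)
      (ascending-length (A + T) d₁) (descending-length B d₂)
      (cycle-via-path O₁ O₂ {k + suc Z₀} {A + suc W₀} pathM′ off
        (≤-trans B≤k (m≤m+n k (suc Z₀)) , k+Z<B+k Z<B)
        (≤-trans B≤A (m≤m+n A (suc W₀)) , <-≤-trans (<-≤-trans A+W<A+T A+T≤k) (m≤n+m k B))
        (inj₂ (subst (_< k + suc Z₀) (sym e₁) (+-monoʳ-< k (n<1+n Z₀))))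
        (inj₁ A+W<A+T)
        (inj₂ (subst (_< k + suc Z₀) (sym e₂) (<-≤-trans A+W₀<k (m≤m+n k (suc Z₀)))))
        (inj₂ (subst (_< A + suc W₀) (sym e₂) (+-monoʳ-< A (n<1+n W₀))))
        (inj₂ (subst (_< A + T) (sym e₂) A+W₀<A+T))
        (subst₂ AdjAt (sym e₁) (sym (+-suc k Z₀)) (at-adjacent (k + Z₀)))
        (subst₂ AdjAt (sym (+-suc A W₀)) (sym e₂) (Adj-sym (at-adjacent (A + W₀))))
        yh lx))
    where
    A+W<A+T : A + suc W₀ < A + T
    A+W<A+T = +-monoʳ-< A W′<T
    A+W₀<A+T : A + W₀ < A + T
    A+W₀<A+T = +-monoʳ-< A (<-trans (n<1+n W₀) W′<T)
    A+W₀<k : A + W₀ < k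
    A+W₀<k = <-≤-trans A+W₀<A+T A+T≤k
    B≤k : B ≤ k
    B≤k = ≤-trans B≤A (≤-trans (m≤m+n A T) A+T≤k)
    k+Z<B+k : ∀ {Z} → Z < B → k + Z < B + k
    k+Z<B+k {Z} Z<B = subst (k + Z <_) (+-comm k B) (+-monoʳ-< k Z<B)
    O₁ O₂ : Arc B
    O₁ = ascendingArc (A + T) d₁ (≤-trans B≤A (m≤m+n A T)) (subst (_< B + k) (sym e₁) (k+Z<B+k (<-trans (n<1+n Z₀) Z<B)))
    O₂ = descendingArc B d₂ ≤-refl (subst (_< B + k) (sym e₂) (<-≤-trans A+W₀<k (m≤n+m k B)))
    pathM′ : IsPath G (at (k + suc Z₀) ∷ ms ∷ʳ at (A + suc W₀))
    pathM′ = subst (λ v → IsPath G (v ∷ ms ∷ʳ at (A + suc W₀))) (sym (at-periodic (suc Z₀))) pathM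

  -- The cycle P, at B forward along C to at (A + V₂), at U₂ back along C to at U₁, at (A + V₁)
  -- forward along C to at k = c a.
  crossing-edges-bound : ∀ {U₁ U₂ B A V₂ V₁} → 0 < U₁ → U₁ < U₂ → U₂ < B → B ≤ A → V₂ < V₁ → A + V₁ < k →
    Adj y (at B) → Adj (at k) x → AdjAt (A + V₂) U₂ → AdjAt U₁ (A + V₁) →
    length P + 3 + V₂ + U₂ ≤ B + U₁ + V₁
  crossing-edges-bound {U₁} {_} {B} {A} {V₂} {V₁} 0<U₁ U₁<U₂ U₂<B B≤A V₂<V₁ A+V₁<k yh kx e₂₂ e₁₁
    with m≤n⇒∃[o]m+o≡n (<⇒≤ U₁<U₂) | m≤n⇒∃[o]m+o≡n (≤-trans B≤A (m≤m+n A V₂)) | m≤n⇒∃[o]m+o≡n (<⇒≤ A+V₁<k)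
  ... | n₁ , refl | n₂ , B+n₂≡A+V₂ | n₃ , A+V₁+n₃≡k = crossing-arithmetic B+n₂≡A+V₂ A+V₁+n₃≡k
    (subst₂ (λ l m → length P + (l + m) ≤ k) (ascending-length B n₂)
      (cong₂ _+_ (descending-length U₁ n₁) (ascending-length (A + V₁) n₃))
      (cycle-via-arcs O₁ O₂ O₃ (inj₂ U₂<B)
        (inj₁ (subst (_< A + V₁) (sym B+n₂≡A+V₂) A+V₂<A+V₁)) (inj₁ (<-trans U₂<B B<A+V₁))
        (subst (λ t → AdjAt t (U₁ + n₁)) (sym B+n₂≡A+V₂) e₂₂) e₁₁
        yh (subst (λ t → Adj (at t) x) (sym A+V₁+n₃≡k) kx)))
    where
    A+V₂<A+V₁ : A + V₂ < A + V₁
    A+V₂<A+V₁ = +-monoʳ-< A V₂<V₁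
    B<A+V₁ : B < A + V₁
    B<A+V₁ = ≤-<-trans (m≤m+n B n₂) (subst (_< A + V₁) (sym B+n₂≡A+V₂) A+V₂<A+V₁)
    A+V₁<1+k : A + V₁ < 1 + k
    A+V₁<1+k = <-trans A+V₁<k (n<1+n k)
    O₁ O₂ O₃ : Arc 1
    O₁ = ascendingArc B n₂ (≤-trans 0<U₁ (<⇒≤ (<-trans U₁<U₂ U₂<B)))
           (subst (_< 1 + k) (sym B+n₂≡A+V₂) (<-trans A+V₂<A+V₁ A+V₁<1+k))
    O₂ = descendingArc U₁ n₁ 0<U₁ (<-trans U₂<B (<-trans B<A+V₁ A+V₁<1+k))
    O₃ = ascendingArc (A + V₁) n₃ (≤-trans 0<U₁ (<⇒≤ (<-trans U₁<U₂ (<-trans U₂<B B<A+V₁))))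
           (subst (_< 1 + k) (sym A+V₁+n₃≡k) (n<1+n k))

-- Elementary segments

module Segments (G : Graph) {k} {c : Fin k → Graph.Vertex G} {x y : Graph.Vertex G} {P : List (Graph.Vertex G)}
    (longest : IsLongestCycle G c) (pathP : IsPath G P) (P-avoids : AvoidsCycle G c P)
    (headP : head P ≡ just x) (lastP : last P ≡ just y)
    (same-neighbours : ∀ j → Graph.Adj G x (c j) ⇔ Graph.Adj G y (c j)) where
  open Graph G using (Vertex; Adj) renaming (sym to Adj-sym)
  open Setting G c x y P

  instance
    k-nonZero : NonZero k
    k-nonZero = >-nonZero (≤-trans (s≤s z≤n) (proj₁ (proj₁ longest)))

  open Modular k using (fdist-injective; fdist-positive; fdist-round-trip)

  Xi⇒adj-x : ∀ {j} → Xi j → Adj x (c j)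
  Xi⇒adj-x     (inj₁ xj) = xj
  Xi⇒adj-x {j} (inj₂ yj) = Equivalence.from (same-neighbours j) yj

  Xi⇒adj-y : ∀ {j} → Xi j → Adj y (c j)
  Xi⇒adj-y {j} (inj₁ xj) = Equivalence.to (same-neighbours j) xj
  Xi⇒adj-y     (inj₂ yj) = yj

  segLen≤fdist : ∀ {a b j} → IsSeg (a , b) → Xi j → a ≢ j → fdist a b ≤ fdist a j
  segLen≤fdist (_ , _ , _ , nothing-between) Xj a≢j =
    ≮⇒≥ λ j-before-b → nothing-between _ (fdist-positive a≢j , j-before-b) Xj

  IsSeg-end-unique : ∀ {a b b′} → IsSeg (a , b) → IsSeg (a , b′) → b ≡ b′
  IsSeg-end-unique {a} S@(a≢b , _ , Xb , _) S′@(a≢b′ , _ , Xb′ , _) =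
    fdist-injective a (≤-antisym (segLen≤fdist S Xb′ a≢b′) (segLen≤fdist S′ Xb a≢b))

  IsSeg-start-injective : ∀ {a b a′ b′} → IsSeg (a , b) → IsSeg (a′ , b′) → (a , b) ≢ (a′ , b′) → a ≢ a′
  IsSeg-start-injective {a} S T S≢T refl = S≢T (cong (a ,_) (IsSeg-end-unique S T))

  -- Offsets are measured from a = ξ_f, so ξ_g sits at A and w ∈ I_g at A + fdist a′ w.
  module SegmentPair {a b a′ b′ : Fin k} (S-seg : IsSeg (a , b)) (T-seg : IsSeg (a′ , b′)) (a≢a′ : a ≢ a′) where
    open CyclesThroughPath G longest a pathP P-avoids headP lastP

    A : ℕ
    A = fdist a a′

    |S|≤A : fdist a b ≤ A
    |S|≤A = segLen≤fdist S-seg (proj₁ (proj₂ T-seg)) a≢a′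

    A+|T|≤k : A + fdist a′ b′ ≤ k
    A+|T|≤k = subst (A + fdist a′ b′ ≤_) (fdist-round-trip a≢a′)
                (+-monoʳ-≤ A (segLen≤fdist T-seg (proj₁ (proj₂ S-seg)) (≢-sym a≢a′)))

    A+W<k : ∀ {W} → W < fdist a′ b′ → A + W < k
    A+W<k W<|T| = <-≤-trans (+-monoʳ-< A W<|T|) A+|T|≤k

    at-k-x : Adj (at k) x
    at-k-x = subst (λ v → Adj v x) (sym at-k≡c-start) (Adj-sym (Xi⇒adj-x (proj₁ (proj₂ S-seg))))

    y-at-|S| : Adj y (at (fdist a b))
    y-at-|S| = subst (Adj y) (c≡at-fdist b) (Xi⇒adj-y (proj₁ (proj₂ (proj₂ S-seg))))

    path-at : ∀ {z w} {ms : List Vertex} → IsPath G (c z ∷ ms ∷ʳ c w) →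
              IsPath G (at (fdist a z) ∷ ms ∷ʳ at (A + fdist a′ w))
    path-at {z} {w} {ms} = subst₂ (λ u v → IsPath G (u ∷ ms ∷ʳ v)) (c≡at-fdist z) (c≡at-fdist-via a′ w)

    intermediate-initial-bound : ∀ {z w} {ms : List Vertex} → Interior (a , b) z → Interior (a′ , b′) w →
      IsPath G (c z ∷ ms ∷ʳ c w) → All OffCycleAndPath ms →
      length P + length ms + 2 ≤ fdist a z + fdist a′ w
    intermediate-initial-bound (0<Z , Z<|S|) (0<W , W<|T|) pathM off =
      initial-arcs-bound 0<Z (<-≤-trans Z<|S| |S|≤A) 0<W (A+W<k W<|T|)
        (subst (Adj y) (c≡at-fdist a′) (Xi⇒adj-y (proj₁ (proj₂ T-seg)))) at-k-x (path-at pathM) off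

    intermediate-final-bound : ∀ {z w} {ms : List Vertex} → Interior (a , b) z → Interior (a′ , b′) w →
      IsPath G (c z ∷ ms ∷ʳ c w) → All OffCycleAndPath ms →
      length P + length ms + 2 + fdist a z + fdist a′ w ≤ fdist a b + fdist a′ b′
    intermediate-final-bound (0<Z , Z<|S|) (0<W , W<|T|) pathM off =
      final-arcs-bound 0<Z Z<|S| |S|≤A 0<W W<|T| A+|T|≤k
        (subst (Adj y) (c≡at-fdist-via a′ b′) (Xi⇒adj-y (proj₁ (proj₂ (proj₂ T-seg)))))
        (subst (λ v → Adj v x) (c≡at-fdist b) (Adj-sym (Xi⇒adj-x (proj₁ (proj₂ (proj₂ S-seg))))))
        (path-at pathM) off

    crossing-bound : ∀ {u₁ u₂ v₁ v₂} → Interior (a , b) u₁ → Interior (a , b) u₂ → Interior (a′ , b′) v₁ →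
      fdist a u₁ < fdist a u₂ → fdist a′ v₂ < fdist a′ v₁ → Adj (c u₁) (c v₁) → Adj (c u₂) (c v₂) →
      length P + 3 + fdist a′ v₂ + fdist a u₂ ≤ fdist a b + fdist a u₁ + fdist a′ v₁
    crossing-bound {u₁} {u₂} {v₁} {v₂} (0<U₁ , _) (_ , U₂<|S|) (_ , V₁<|T|) U₁<U₂ V₂<V₁ u₁v₁ u₂v₂ =
      crossing-edges-bound 0<U₁ U₁<U₂ U₂<|S| |S|≤A V₂<V₁ (A+W<k V₁<|T|) y-at-|S| at-k-x
        (subst₂ Adj (c≡at-fdist-via a′ v₂) (c≡at-fdist u₂) (Adj-sym u₂v₂))
        (subst₂ Adj (c≡at-fdist u₁) (c≡at-fdist-via a′ v₁) u₁v₁)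

  InΥ-nonempty⇒distinct : ∀ {S T ε} → 1 ≤ ε → HasCard (InΥ S T) ε → S ≢ T
  InΥ-nonempty⇒distinct _  (_ ∷ _ , _ , _ , i ∷ _ , _) = proj₁ i
  InΥ-nonempty⇒distinct () ([] , refl , _)

  module IntermediatePaths {a b a′ b′ : Fin k} (S-seg : IsSeg (a , b)) (T-seg : IsSeg (a′ , b′))
                      (S≢T : (a , b) ≢ (a′ , b′)) where
    open SegmentPair S-seg T-seg (IsSeg-start-injective S-seg T-seg S≢T)
    module Reversed = SegmentPair T-seg S-seg (≢-sym (IsSeg-start-injective S-seg T-seg S≢T))

    p s : ℕ
    p = plen G P
    s = fdist a b + fdist a′ b′

    weight : Triple → ℕ
    weight (z , w , _) = fdist a z + fdist a′ w

    length-P : length P ≡ suc p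
    length-P = sym (trans (+-comm 1 p) (m∸n+n≡m (≢[]⇒1≤length (proj₁ pathP))))

    length-P+ : ∀ m → length P + m + 2 ≡ p + (m + 1) + 2
    length-P+ m = cong (_+ 2) (trans (cong (_+ m) length-P) (trans (sym (+-suc p m)) (cong (p +_) (+-comm 1 m))))

    Υ-lower : ∀ t → InΥ (a , b) (a′ , b′) t → p + Llen t + 2 ≤ weight t
    Υ-lower (z , w , ms) (_ , iz , iw , pathM , off) =
      subst (_≤ weight (z , w , ms)) (length-P+ (length ms)) (intermediate-initial-bound iz iw pathM off)

    Υ-upper : ∀ t → InΥ (a , b) (a′ , b′) t → p + Llen t + 2 + weight t ≤ s
    Υ-upper (z , w , ms) (_ , iz , iw , pathM , off) =
      subst (_≤ s) (trans (+-assoc (length P + length ms + 2) _ _) (cong (_+ weight (z , w , ms)) (length-P+ (length ms))))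
        (intermediate-final-bound iz iw pathM off)

    intermediate-path-bound : ∀ t → InΥ (a , b) (a′ , b′) t → 2 * p + 2 * Llen t + 4 ≤ s
    intermediate-path-bound t i =
      subst (_≤ s) (twice p (Llen t))
        (sum-below {e′ = p + Llen t + 2} (Υ-lower t i) (Υ-upper t i) (≤-reflexive (+-identityʳ (weight t))))
      where
      twice : ∀ p ℓ → p + ℓ + 2 + (p + ℓ + 2) + 0 ≡ 2 * p + 2 * ℓ + 4
      twice = solve-∀

    module SingleEdges (single : ∀ t → InΥ (a , b) (a′ , b′) t → Llen t ≡ 1) where

      edge : Fin k → Fin k → Triple
      edge z w = z , w , []

      Edge : Fin k → Fin k → Set
      Edge z w = InΥ (a , b) (a′ , b′) (edge z w)

      no-inner-vertices : ∀ {z w ms} → InΥ (a , b) (a′ , b′) (z , w , ms) → ms ≡ []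
      no-inner-vertices {ms = []}    _ = refl
      no-inner-vertices {ms = _ ∷ ms} i = contradiction (trans (+-comm 1 (length ms)) (suc-injective (single _ i))) 1+n≢0

      single-edge-length : ∀ {t} → InΥ (a , b) (a′ , b′) t → p + Llen t + 2 ≡ p + 3
      single-edge-length {t} i = trans (cong (λ ℓ → p + ℓ + 2) (single t i)) (+-assoc p 1 2)

      edge-lower : ∀ {t} → InΥ (a , b) (a′ , b′) t → p + 3 ≤ weight t
      edge-lower {t} i = subst (_≤ weight t) (single-edge-length i) (Υ-lower t i)

      edge-upper : ∀ {t} → InΥ (a , b) (a′ , b′) t → p + 3 + weight t ≤ s
      edge-upper {t} i = subst (_≤ s) (cong (_+ weight t) (single-edge-length i)) (Υ-upper t i)

      edges-gap : ∀ {t t′ d} → InΥ (a , b) (a′ , b′) t → InΥ (a , b) (a′ , b′) t′ → weight t + d ≤ weight t′ →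
                  p + 3 + (p + 3) + d ≤ s
      edges-gap i i′ = sum-below {e′ = p + 3} (edge-lower i) (edge-upper i′)

      edge-adjacent : ∀ {z w} → Edge z w → Adj (c z) (c w)
      edge-adjacent (_ , _ , _ , (_ , _ , z∼w ∷ _) , _) = z∼w

      crossing-edges : ∀ {z₁ w₁ z₂ w₂} → Edge z₁ w₁ → Edge z₂ w₂ →
                       fdist a z₁ < fdist a z₂ → fdist a′ w₂ < fdist a′ w₁ → p + 3 + (p + 3) + 2 ≤ s
      crossing-edges {z₁} {w₁} {z₂} {w₂} e₁@(_ , iz₁ , iw₁ , _) e₂@(_ , iz₂ , iw₂ , _) Z₁<Z₂ W₂<W₁ =
        subst (_≤ s) (trans (cong (λ L → L + 3 + (L + 3)) length-P) (shift p))
          (crossing-sum {length P + 3} {fdist a z₁} {fdist a′ w₁} {fdist a z₂} {fdist a′ w₂}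
            (crossing-bound iz₁ iz₂ iw₁ Z₁<Z₂ W₂<W₁ (edge-adjacent e₁) (edge-adjacent e₂))
            (Reversed.crossing-bound iw₂ iw₁ iz₂ W₂<W₁ Z₁<Z₂ (Adj-sym (edge-adjacent e₂)) (Adj-sym (edge-adjacent e₁))))
        where
        shift : ∀ p → suc p + 3 + (suc p + 3) ≡ p + 3 + (p + 3) + 2
        shift = solve-∀

      disjoint-edges : ∀ {z₁ w₁ z₂ w₂} → Edge z₁ w₁ → Edge z₂ w₂ → z₁ ≢ z₂ → w₁ ≢ w₂ → p + 3 + (p + 3) + 2 ≤ s
      disjoint-edges {z₁} {w₁} {z₂} {w₂} e₁ e₂ z₁≢z₂ w₁≢w₂
        with <-cmp (fdist a z₁) (fdist a z₂) | <-cmp (fdist a′ w₁) (fdist a′ w₂)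
      ... | tri< Z₁<Z₂ _ _ | tri< W₁<W₂ _ _ = edges-gap e₁ e₂ (<-<⇒+2≤+ Z₁<Z₂ W₁<W₂)
      ... | tri< Z₁<Z₂ _ _ | tri> _ _ W₂<W₁ = crossing-edges e₁ e₂ Z₁<Z₂ W₂<W₁
      ... | tri> _ _ Z₂<Z₁ | tri< W₁<W₂ _ _ = crossing-edges e₂ e₁ Z₂<Z₁ W₁<W₂
      ... | tri> _ _ Z₂<Z₁ | tri> _ _ W₂<W₁ = edges-gap e₂ e₁ (<-<⇒+2≤+ Z₂<Z₁ W₂<W₁)
      ... | tri≈ _ Z₁≡Z₂ _ | _              = contradiction (fdist-injective a Z₁≡Z₂) z₁≢z₂
      ... | _              | tri≈ _ W₁≡W₂ _ = contradiction (fdist-injective a′ W₁≡W₂) w₁≢w₂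

      distinct-edges : ∀ {z₁ w₁ z₂ w₂} → Edge z₁ w₁ → Edge z₂ w₂ → edge z₁ w₁ ≢ edge z₂ w₂ →
        p + 3 + (p + 3) + 2 ≤ s ⊎ weight (edge z₁ w₁) ≢ weight (edge z₂ w₂)
      distinct-edges {z₁} {w₁} {z₂} {w₂} e₁ e₂ t₁≢t₂ with z₁ ≟ᶠ z₂ | w₁ ≟ᶠ w₂
      ... | yes refl | yes refl = contradiction refl t₁≢t₂
      ... | yes refl | no w₁≢w₂ = inj₂ (w₁≢w₂ ∘ fdist-injective a′ ∘ +-cancelˡ-≡ (fdist a z₁) _ _)
      ... | no z₁≢z₂ | yes refl = inj₂ (z₁≢z₂ ∘ fdist-injective a ∘ +-cancelʳ-≡ (fdist a′ w₁) _ _)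
      ... | no z₁≢z₂ | no w₁≢w₂ = inj₁ (disjoint-edges e₁ e₂ z₁≢z₂ w₁≢w₂)

      two-edges-bound : ∀ {t₁ t₂} → InΥ (a , b) (a′ , b′) t₁ → InΥ (a , b) (a′ , b′) t₂ → t₁ ≢ t₂ →
                        p + 3 + (p + 3) + 1 ≤ s
      two-edges-bound {_ , _ , ms₁} {_ , _ , ms₂} i₁ i₂ t₁≢t₂ with no-inner-vertices i₁ | no-inner-vertices i₂
      ... | refl | refl with distinct-edges i₁ i₂ t₁≢t₂
      ...   | inj₁ bound = ≤-trans (+-monoʳ-≤ (p + 3 + (p + 3)) (n≤1+n 1)) bound
      ...   | inj₂ σ₁≢σ₂ with <-cmp (weight (edge _ _)) (weight (edge _ _))
      ...     | tri< σ₁<σ₂ _ _ = edges-gap i₁ i₂ (<⇒+1≤ σ₁<σ₂)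
      ...     | tri≈ _ σ₁≡σ₂ _ = contradiction σ₁≡σ₂ σ₁≢σ₂
      ...     | tri> _ _ σ₂<σ₁ = edges-gap i₂ i₁ (<⇒+1≤ σ₂<σ₁)

      three-edges-bound : ∀ {t₁ t₂ t₃} → InΥ (a , b) (a′ , b′) t₁ → InΥ (a , b) (a′ , b′) t₂ → InΥ (a , b) (a′ , b′) t₃ →
                          t₁ ≢ t₂ → t₁ ≢ t₃ → t₂ ≢ t₃ → p + 3 + (p + 3) + 2 ≤ s
      three-edges-bound {_ , _ , ms₁} {_ , _ , ms₂} {_ , _ , ms₃} i₁ i₂ i₃ t₁≢t₂ t₁≢t₃ t₂≢t₃
        with no-inner-vertices i₁ | no-inner-vertices i₂ | no-inner-vertices i₃
      ... | refl | refl | refl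
        with distinct-edges i₁ i₂ t₁≢t₂ | distinct-edges i₁ i₃ t₁≢t₃ | distinct-edges i₂ i₃ t₂≢t₃
      ...   | inj₁ bound | _          | _          = bound
      ...   | inj₂ _     | inj₁ bound | _          = bound
      ...   | inj₂ _     | inj₂ _     | inj₁ bound = bound
      ...   | inj₂ σ₁≢σ₂ | inj₂ σ₁≢σ₃ | inj₂ σ₂≢σ₃ with three-values-spread weight σ₁≢σ₂ σ₁≢σ₃ σ₂≢σ₃
      ...     | _ , _ , i∈ , j∈ , gap = edges-gap (edges i∈) (edges j∈) gap
        where
        edges : ∀ {t} → t ∈ _ → InΥ (a , b) (a′ , b′) t
        edges = All.lookup {P = InΥ (a , b) (a′ , b′)} (i₁ ∷ i₂ ∷ i₃ ∷ [])

      independent-edges-bound : ∀ {t₁ t₂} → InΥ (a , b) (a′ , b′) t₁ → InΥ (a , b) (a′ , b′) t₂ → Independent t₁ t₂ →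
                                2 * p + 8 ≤ s
      independent-edges-bound {_ , _ , ms₁} {_ , _ , ms₂} i₁ i₂ (cz₁≢cz₂ , _ , _ , cw₁≢cw₂)
        with no-inner-vertices i₁ | no-inner-vertices i₂
      ... | refl | refl = subst (_≤ s) (trans ([p+3]+[p+3]+d≡2p+[d+1]+5 p 2) (+-assoc (2 * p) 3 5))
                            (disjoint-edges i₁ i₂ (cz₁≢cz₂ ∘ cong c) (cw₁≢cw₂ ∘ cong c))

      counted-edges-bound : ∀ ε → 1 ≤ ε → ε ≤ 3 → HasCard (InΥ (a , b) (a′ , b′)) ε → 2 * p + ε + 5 ≤ s
      counted-edges-bound .1 _ _ (t ∷ [] , refl , _ , i ∷ [] , _) =
        subst (_≤ s) (trans (cong (λ ℓ → 2 * p + 2 * ℓ + 4) (single t i))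
                            (trans (+-assoc (2 * p) 2 4) (sym (+-assoc (2 * p) 1 5))))
          (intermediate-path-bound t i)
      counted-edges-bound .2 _ _ (t₁ ∷ t₂ ∷ [] , refl , (t₁≢t₂ ∷ []) ∷ _ , i₁ ∷ i₂ ∷ [] , _) =
        subst (_≤ s) ([p+3]+[p+3]+d≡2p+[d+1]+5 p 1) (two-edges-bound i₁ i₂ t₁≢t₂)
      counted-edges-bound .3 _ _
        (t₁ ∷ t₂ ∷ t₃ ∷ [] , refl , (t₁≢t₂ ∷ t₁≢t₃ ∷ []) ∷ (t₂≢t₃ ∷ []) ∷ _ , i₁ ∷ i₂ ∷ i₃ ∷ [] , _) =
        subst (_≤ s) ([p+3]+[p+3]+d≡2p+[d+1]+5 p 2) (three-edges-bound i₁ i₂ i₃ t₁≢t₂ t₁≢t₃ t₂≢t₃)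
      counted-edges-bound .0 () _ ([] , refl , _)
      counted-edges-bound _ _ (s≤s (s≤s (s≤s ()))) (_ ∷ _ ∷ _ ∷ _ ∷ _ , refl , _)

lemma2 : (G : Graph) (k : ℕ) (c : Fin k → Graph.Vertex G)
    (x y : Graph.Vertex G) (P : List (Graph.Vertex G)) →
    IsLongestCycle G c →
    IsLongestPathOff G c P →
    head P ≡ just x →
    last P ≡ just y →
    (∀ j → Graph.Adj G x (c j) ⇔ Graph.Adj G y (c j)) →
    AtLeastTwoCNbrs G c x →
    (S T : Fin k × Fin k) →
    Setting.IsSeg G c x y P S →
    Setting.IsSeg G c x y P T →
    ((t : Setting.Triple G c x y P) →
      Setting.InΥ G c x y P S T t →
      2 * plen G P + 2 * Setting.Llen G c x y P t + 4
        ≤ Setting.segLen G c x y P S + Setting.segLen G c x y P T)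
    × ((ε : ℕ) → 1 ≤ ε → ε ≤ 3 →
      (∀ t → Setting.InΥ G c x y P S T t → Setting.Llen G c x y P t ≡ 1) →
      Setting.HasCard G c x y P (Setting.InΥ G c x y P S T) ε →
      2 * plen G P + ε + 5
        ≤ Setting.segLen G c x y P S + Setting.segLen G c x y P T)
    × ((∀ t → Setting.InΥ G c x y P S T t → Setting.Llen G c x y P t ≡ 1) →
      (t₁ t₂ : Setting.Triple G c x y P) →
      Setting.InΥ G c x y P S T t₁ →
      Setting.InΥ G c x y P S T t₂ →
      Setting.Independent G c x y P t₁ t₂ →
      2 * plen G P + 8
        ≤ Setting.segLen G c x y P S + Setting.segLen G c x y P T)
lemma2 G k c x y P longest P-longest headP lastP same-neighbours _ (a , b) (a′ , b′) S-seg T-seg =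
    (λ t i → intermediate-path-bound (proj₁ i) t i)
  , (λ ε 1≤ε ε≤3 single card →
       SingleEdges.counted-edges-bound (InΥ-nonempty⇒distinct 1≤ε card) single ε 1≤ε ε≤3 card)
  , (λ single t₁ t₂ i₁ i₂ → SingleEdges.independent-edges-bound (proj₁ i₁) single i₁ i₂)
  where
  open Segments G longest (proj₁ P-longest) (proj₁ (proj₂ P-longest)) headP lastP same-neighbours
  open IntermediatePaths S-seg T-seg
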